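{- Let $k,n$ be integers with $1\leq k\leq n-2$, and let $G$ be a connected graph of order $n$. Then $sdiam_{n-k}(G)=n-1$ if and only if $G$ contains at least $k$ cut vertices.
   Context: For a connected graph $G$ and $S\subseteq V(G)$, the Steiner distance $d_G(S)$ is the minimum number of edges of a connected subgraph (equivalently, a subtree) of $G$ whose vertex set contains $S$. For $2\leq k\leq |V(G)|$, the Steiner $k$-diameter is $sdiam_k(G)=\max\{d_G(S): S\subseteq V(G),\ |S|=k\}$ (equivalently, the maximum over vertices $v$ of the Steiner $k$-eccentricity $e_k(v)=\max\{d_G(S): |S|=k,\ v\in S\}$). A cut vertex of $G$ is a vertex whose removal disconnects $G$. -}

module Defs where

open import Data.Nat using (ℕ; zero; suc; _+_; _≤_; _<_)
open import Data.Nat.Properties using (_<?_)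
open import Data.Bool using (Bool; true; false; _∧_; if_then_else_)
open import Data.Fin using (Fin; toℕ)
open import Data.Fin.Subset using (Subset; _∈_; _∉_; _⊆_; ∣_∣; ⁅_⁆; ∁; ⊤)
open import Data.List using (List; map; allFin)
open import Data.Nat.ListAction using (sum)
open import Data.Product using (Σ; ∃; _×_; Σ-syntax)
open import Relation.Nullary using (¬_; does)
open import Relation.Binary.PropositionalEquality using (_≡_; _≢_)
open import Function.Definitions using (Injective)

record Graph (n : ℕ) : Set where
  field
    adj    : Fin n → Fin n → Bool
    sym    : ∀ i j → adj i j ≡ adj j i
    irrefl : ∀ i → adj i i ≡ false
open Graph public

data Walk {n : ℕ} (W : Subset n) (E : Fin n → Fin n → Bool) : Fin n → Fin n → Set where
  here : ∀ {u} → u ∈ W → Walk W E u u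
  step : ∀ {u x w} → u ∈ W → E u x ≡ true → Walk W E x w → Walk W E u w

IsConnectedOn : {n : ℕ} → Subset n → (Fin n → Fin n → Bool) → Set
IsConnectedOn W E = ∀ u w → u ∈ W → w ∈ W → Walk W E u w

Connected : {n : ℕ} → Graph n → Set
Connected G = IsConnectedOn ⊤ (adj G)

edgeCount : {n : ℕ} → (Fin n → Fin n → Bool) → ℕ
edgeCount {n} E =
  sum (map (λ i → sum (map (λ j → if does (toℕ i <? toℕ j) ∧ E i j then 1 else 0) (allFin n))) (allFin n))

record ConnSubgraph {n : ℕ} (G : Graph n) (S : Subset n) : Set where
  field
    W      : Subset n
    E      : Fin n → Fin n → Bool
    Esym   : ∀ i j → E i j ≡ E j i
    Esub   : ∀ i j → E i j ≡ true → adj G i j ≡ true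
    Eends  : ∀ i j → E i j ≡ true → i ∈ W × j ∈ W
    conn   : IsConnectedOn W E
    S⊆W    : S ⊆ W
open ConnSubgraph public

-- d_G(S) = d : minimum number of edges of a connected subgraph containing S.
IsSteinerDist : {n : ℕ} → Graph n → Subset n → ℕ → Set
IsSteinerDist G S d =
  (Σ[ H ∈ ConnSubgraph G S ] edgeCount (E H) ≡ d) ×
  (∀ (H : ConnSubgraph G S) → d ≤ edgeCount (E H))

-- sdiam_k(G) = D : maximum of d_G(S) over all S with |S| = k.
IsSteinerDiam : {n : ℕ} → Graph n → ℕ → ℕ → Set
IsSteinerDiam G k D =
  (Σ[ S ∈ Subset _ ] (∣ S ∣ ≡ k × IsSteinerDist G S D)) ×
  (∀ (S : Subset _) (d : ℕ) → ∣ S ∣ ≡ k → IsSteinerDist G S d → d ≤ D)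

IsCutVertex : {n : ℕ} → Graph n → Fin n → Set
IsCutVertex G v = ¬ IsConnectedOn (∁ ⁅ v ⁆) (adj G)

AtLeastCutVertices : {n : ℕ} → Graph n → ℕ → Set
AtLeastCutVertices {n} G k =
  Σ[ f ∈ (Fin k → Fin n) ] (Injective _≡_ _≡_ f × (∀ i → IsCutVertex G (f i)))

-- If d(S) = n - 1 for some S with |S| = n - k, every vertex v outside S is a cut vertex: otherwise
-- a spanning tree of G - v contains S and has only n - 2 edges. Conversely, if every vertex outside
-- S is a cut vertex, a connected subgraph H containing S spans G: otherwise grow V(H) one adjacent
-- vertex at a time until it covers G; the vertex added last is not a cut vertex, yet lies outside
-- H ⊇ S. Hence H has at least n - 1 edges, and a spanning tree of G has exactly n - 1.
-- That a connected graph on W has at least ∣W∣ - 1 edges and a spanning tree with at most ∣W∣ - 1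
-- edges follows from the same growth of a vertex set one adjacent vertex at a time.

module Submission where

open import Defs hiding (sym)
open import Data.Bool using (Bool; true; false; _∧_; _∨_; if_then_else_)
open import Data.Bool.Properties using (∧-zeroʳ; ∨-zeroʳ)
open import Data.Fin using (Fin; zero; suc; toℕ; _≟_)
open import Data.Fin.Properties using (any?; toℕ-injective; suc-injective)
open import Data.Fin.Subset using (Subset; _∈_; _∉_; _⊆_; _⊂_; _⊃_; ∣_∣; ⁅_⁆; ∁; ⊤; _∪_; inside; outside; Nonempty)
import Data.Fin.Subset as Subset
open import Data.Fin.Subset.Induction using (⊃-wellFounded)
open import Data.Fin.Subset.Properties
  using (_∈?_; ⊆-antisym; ∪-identityʳ; p⊆p∪q; x∈p∪q⁺; x∈p∪q⁻; x∈⁅x⁆; x∈⁅y⁆⇒x≡y; ∣⁅x⁆∣≡1;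
         ∈⊤; ∣⊤∣≡n; ∣⊥∣≡0; ∉⊥; ∣∁p∣≡n∸∣p∣; x∉p⇒x∈∁p; x∈∁p⇒x∉p; x∉∁p⇒x∈p; p⊆q⇒∣p∣≤∣q∣; nonempty?; Empty-unique)
open import Data.List using (map; allFin; tabulate)
open import Data.List.Properties using (map-tabulate)
open import Data.Nat using (ℕ; zero; suc; _+_; _∸_; _≤_; _<_; z≤n; s≤s)
open import Data.Nat.ListAction using (sum)
open import Data.Nat.Properties hiding (suc-injective; _≟_)
open import Algebra.Properties.Semiring.Sum +-*-semiring
  using (sum-cong-≗; sum-replicate-zero; ∑-distrib-+) renaming (sum to ∑)
open import Data.Product using (∃; Σ-syntax; _×_; _,_; proj₁; proj₂)
open import Data.Sum using (_⊎_; inj₁; inj₂)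
import Data.Sum as Sum
import Data.Product as Product
open import Data.Vec using (_∷_; here; there)
open import Function using (_∘_; id)
open import Function.Bundles using (_⇔_; mk⇔; Equivalence)
open import Function.Definitions using (Injective)
open import Induction.WellFounded using (Acc; acc)
open import Relation.Binary.Definitions using (tri<; tri≈; tri>)
open import Relation.Binary.PropositionalEquality
open import Relation.Nullary using (Dec; yes; no; does; ¬_; contradiction)
open import Relation.Nullary.Decidable using (decidable-stable; dec-true; dec-false; does-⇔; _×-dec_; _⊎-dec_; ¬?)

private
  variable
    n : ℕ

does-true : ∀ {P : Set} (P? : Dec P) → does P? ≡ true → P
does-true (yes p) _ = p
does-true (no _) ()

sum-allFin : ∀ (f : Fin n → ℕ) → sum (map f (allFin n)) ≡ ∑ f
sum-allFin {n} f = trans (cong sum (map-tabulate id f)) (sum-tabulate f)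
  where
  sum-tabulate : ∀ {m} (g : Fin m → ℕ) → sum (tabulate g) ≡ ∑ g
  sum-tabulate {zero} g = refl
  sum-tabulate {suc m} g = cong (g zero +_) (sum-tabulate (g ∘ suc))

∑-zero : ∀ {f : Fin n → ℕ} → (∀ i → f i ≡ 0) → ∑ f ≡ 0
∑-zero {n} f≡0 = trans (sum-cong-≗ f≡0) (sum-replicate-zero n)

∑-point : ∀ {f : Fin n → ℕ} a → (∀ i → i ≢ a → f i ≡ 0) → ∑ f ≡ f a
∑-point {suc n} {f} zero f≡0 =
  trans (cong (f zero +_) (∑-zero (λ i → f≡0 (suc i) λ ()))) (+-identityʳ (f zero))
∑-point {suc n} {f} (suc a) f≡0 =
  trans (cong (_+ ∑ (f ∘ suc)) (f≡0 zero λ ()))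
        (∑-point a (λ i i≢a → f≡0 (suc i) (i≢a ∘ suc-injective)))

∑-mono-≤ : ∀ {f g : Fin n → ℕ} → (∀ i → f i ≤ g i) → ∑ f ≤ ∑ g
∑-mono-≤ {zero} f≤g = z≤n
∑-mono-≤ {suc n} f≤g = +-mono-≤ (f≤g zero) (∑-mono-≤ (f≤g ∘ suc))

∑-mono-< : ∀ {f g : Fin n → ℕ} → (∀ i → f i ≤ g i) → ∀ a → f a < g a → ∑ f < ∑ g
∑-mono-< f≤g zero fa<ga = +-mono-<-≤ fa<ga (∑-mono-≤ (f≤g ∘ suc))
∑-mono-< f≤g (suc a) fa<ga = +-mono-≤-< (f≤g zero) (∑-mono-< (f≤g ∘ suc) a fa<ga)

EdgeRel : ℕ → Set
EdgeRel n = Fin n → Fin n → Bool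

AllEdges : (Fin n → Fin n → Set) → EdgeRel n → Set
AllEdges P E = ∀ i j → E i j ≡ true → P i j

_⊆ᴱ_ : EdgeRel n → EdgeRel n → Set
E ⊆ᴱ E′ = AllEdges (λ i j → E′ i j ≡ true) E

EdgesWithin : EdgeRel n → Subset n → Set
EdgesWithin E W = AllEdges (λ i j → i ∈ W × j ∈ W) E

SymmetricRel : EdgeRel n → Set
SymmetricRel E = ∀ i j → E i j ≡ E j i

∅ᴱ : EdgeRel n
∅ᴱ _ _ = false

_∪ᴱ_ : EdgeRel n → EdgeRel n → EdgeRel n
(E ∪ᴱ E′) i j = E i j ∨ E′ i j

∪ᴱ-elim : ∀ {P : Fin n → Fin n → Set} {E E′} → AllEdges P E → AllEdges P E′ → AllEdges P (E ∪ᴱ E′)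
∪ᴱ-elim {E = E} PE PE′ i j e with E i j in eq
... | true  = PE i j eq
... | false = PE′ i j e

⊆ᴱ-refl : ∀ {E : EdgeRel n} → E ⊆ᴱ E
⊆ᴱ-refl _ _ e = e

⊆ᴱ-∪ᴱˡ : ∀ {E E′ : EdgeRel n} → E ⊆ᴱ (E ∪ᴱ E′)
⊆ᴱ-∪ᴱˡ i j e rewrite e = refl

⊆ᴱ-∪ᴱʳ : ∀ {E E′ : EdgeRel n} → E′ ⊆ᴱ (E ∪ᴱ E′)
⊆ᴱ-∪ᴱʳ {E = E} i j e rewrite e = ∨-zeroʳ (E i j)

edgeIndicator : EdgeRel n → Fin n → Fin n → ℕ
edgeIndicator E i j = if does (toℕ i <? toℕ j) ∧ E i j then 1 else 0

edgeCount≡∑∑ : ∀ (E : EdgeRel n) → edgeCount E ≡ ∑ (λ i → ∑ (edgeIndicator E i))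
edgeCount≡∑∑ E =
  trans (sum-allFin (λ i → sum (map (edgeIndicator E i) (allFin _)))) (sum-cong-≗ λ i → sum-allFin (edgeIndicator E i))

edgeCount-∅ᴱ : edgeCount (∅ᴱ {n}) ≡ 0
edgeCount-∅ᴱ {n} = trans (edgeCount≡∑∑ (∅ᴱ {n})) (∑-zero {f = λ i → ∑ (edgeIndicator (∅ᴱ {n}) i)} λ i →
  ∑-zero {f = edgeIndicator ∅ᴱ i} λ j → cong (λ c → if c then 1 else 0) (∧-zeroʳ (does (toℕ i <? toℕ j))))

edgeIndicator≤1 : ∀ (E : EdgeRel n) i j → edgeIndicator E i j ≤ 1
edgeIndicator≤1 E i j with does (toℕ i <? toℕ j) ∧ E i j
... | true  = ≤-refl
... | false = z≤n

edgeIndicator-mono : ∀ {E E′ : EdgeRel n} → E ⊆ᴱ E′ → ∀ i j → edgeIndicator E i j ≤ edgeIndicator E′ i j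
edgeIndicator-mono {E = E} {E′} E⊆E′ i j with does (toℕ i <? toℕ j) | E i j in eq | E′ i j in eq′
... | false | _     | _     = z≤n
... | true  | false | _     = z≤n
... | true  | true  | true  = ≤-refl
... | true  | true  | false = contradiction (trans (sym eq′) (E⊆E′ i j eq)) λ ()

edgeIndicator-∪ᴱ : ∀ (E E′ : EdgeRel n) i j →
                   edgeIndicator (E ∪ᴱ E′) i j ≤ edgeIndicator E i j + edgeIndicator E′ i j
edgeIndicator-∪ᴱ E E′ i j with does (toℕ i <? toℕ j) | E i j
... | false | _     = z≤n
... | true  | true  = s≤s z≤n
... | true  | false = ≤-refl

edgeIndicator-< : ∀ {E E′ : EdgeRel n} {i j} → toℕ i < toℕ j → E i j ≡ false → E′ i j ≡ true →
                  edgeIndicator E i j < edgeIndicator E′ i j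
edgeIndicator-< {i = i} {j} i<j e e′ rewrite dec-true (toℕ i <? toℕ j) i<j | e | e′ = s≤s z≤n

edgeCount-mono : ∀ {E E′ : EdgeRel n} → E ⊆ᴱ E′ → edgeCount E ≤ edgeCount E′
edgeCount-mono {E = E} {E′} E⊆E′ = subst₂ _≤_ (sym (edgeCount≡∑∑ E)) (sym (edgeCount≡∑∑ E′))
  (∑-mono-≤ λ i → ∑-mono-≤ (edgeIndicator-mono E⊆E′ i))

edgeCount-∪ᴱ : ∀ (E E′ : EdgeRel n) → edgeCount (E ∪ᴱ E′) ≤ edgeCount E + edgeCount E′
edgeCount-∪ᴱ E E′ = begin
  edgeCount (E ∪ᴱ E′)                                            ≡⟨ edgeCount≡∑∑ (E ∪ᴱ E′) ⟩
  ∑ (row (E ∪ᴱ E′))                                              ≤⟨ ∑-mono-≤ (λ i → ∑-mono-≤ (edgeIndicator-∪ᴱ E E′ i)) ⟩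
  ∑ (λ i → ∑ (λ j → edgeIndicator E i j + edgeIndicator E′ i j)) ≡⟨ sum-cong-≗ (λ i → ∑-distrib-+ (edgeIndicator E i) _) ⟩
  ∑ (λ i → row E i + row E′ i)                                   ≡⟨ ∑-distrib-+ (row E) (row E′) ⟩
  ∑ (row E) + ∑ (row E′)                                         ≡⟨ sym (cong₂ _+_ (edgeCount≡∑∑ E) (edgeCount≡∑∑ E′)) ⟩
  edgeCount E + edgeCount E′                                     ∎
  where
  open ≤-Reasoning
  row : EdgeRel _ → Fin _ → ℕ
  row F i = ∑ (edgeIndicator F i)

edgeCount-< : ∀ {E E′ : EdgeRel n} {a b} → E ⊆ᴱ E′ → toℕ a < toℕ b → E a b ≡ false → E′ a b ≡ true →
              edgeCount E < edgeCount E′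
edgeCount-< {E = E} {E′} {a} {b} E⊆E′ a<b e e′ = subst₂ _<_ (sym (edgeCount≡∑∑ E)) (sym (edgeCount≡∑∑ E′))
  (∑-mono-< (λ i → ∑-mono-≤ (edgeIndicator-mono E⊆E′ i)) a
    (∑-mono-< (edgeIndicator-mono E⊆E′ a) b (edgeIndicator-< {E = E} {E′} a<b e e′)))

edgeCount-<-sym : ∀ {E E′ : EdgeRel n} {a b} → E ⊆ᴱ E′ → a ≢ b →
                  E a b ≡ false → E b a ≡ false → E′ a b ≡ true → E′ b a ≡ true →
                  edgeCount E < edgeCount E′
edgeCount-<-sym {a = a} {b} E⊆E′ a≢b eab eba e′ab e′ba with <-cmp (toℕ a) (toℕ b)
... | tri< a<b _ _ = edgeCount-< E⊆E′ a<b eab e′ab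
... | tri≈ _ a≡b _ = contradiction (toℕ-injective a≡b) a≢b
... | tri> _ _ b<a = edgeCount-< E⊆E′ b<a eba e′ba

IsEdge : Fin n → Fin n → Fin n → Fin n → Set
IsEdge a b i j = (i ≡ a × j ≡ b) ⊎ (i ≡ b × j ≡ a)

isEdge? : ∀ (a b i j : Fin n) → Dec (IsEdge a b i j)
isEdge? a b i j = (i ≟ a ×-dec j ≟ b) ⊎-dec (i ≟ b ×-dec j ≟ a)

edge : Fin n → Fin n → EdgeRel n
edge a b i j = does (isEdge? a b i j)

edge⁻ : ∀ (a b i j : Fin n) → edge a b i j ≡ true → IsEdge a b i j
edge⁻ a b i j = does-true (isEdge? a b i j)

edge-sym : ∀ (a b : Fin n) → SymmetricRel (edge a b)
edge-sym a b i j = does-⇔ (mk⇔ flip flip) (isEdge? a b i j) (isEdge? a b j i)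
  where
  flip : ∀ {i j} → IsEdge a b i j → IsEdge a b j i
  flip (inj₁ (i≡a , j≡b)) = inj₂ (j≡b , i≡a)
  flip (inj₂ (i≡b , j≡a)) = inj₁ (j≡a , i≡b)

edge-forward : ∀ (a b : Fin n) → edge a b a b ≡ true
edge-forward a b = dec-true (isEdge? a b a b) (inj₁ (refl , refl))

edge-backward : ∀ (a b : Fin n) → edge a b b a ≡ true
edge-backward a b = dec-true (isEdge? a b b a) (inj₂ (refl , refl))

edge-comm : ∀ (a b : Fin n) i j → edge a b i j ≡ edge b a i j
edge-comm a b i j = does-⇔ (mk⇔ Sum.swap Sum.swap) (isEdge? a b i j) (isEdge? b a i j)

edgeCount-edge-< : ∀ {a b : Fin n} → toℕ a < toℕ b → edgeCount (edge a b) ≤ 1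
edgeCount-edge-< {a = a} {b} a<b = begin
  edgeCount (edge a b)                     ≡⟨ edgeCount≡∑∑ (edge a b) ⟩
  ∑ (λ i → ∑ (edgeIndicator (edge a b) i)) ≡⟨ ∑-point a (λ i i≢a → ∑-zero λ j → off-ab {i} {j} (i≢a ∘ proj₁)) ⟩
  ∑ (edgeIndicator (edge a b) a)           ≡⟨ ∑-point b (λ j j≢b → off-ab {a} {j} (j≢b ∘ proj₂)) ⟩
  edgeIndicator (edge a b) a b             ≤⟨ edgeIndicator≤1 (edge a b) a b ⟩
  1                                        ∎
  where
  open ≤-Reasoning
  off-ab : ∀ {i j} → ¬ (i ≡ a × j ≡ b) → edgeIndicator (edge a b) i j ≡ 0
  off-ab {i} {j} ¬ab with edge a b i j in e
  ... | false = cong (λ c → if c then 1 else 0) (∧-zeroʳ _)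
  ... | true with edge⁻ a b i j e
  ...   | inj₁ ab = contradiction ab ¬ab
  ...   | inj₂ (refl , refl) rewrite dec-false (toℕ b <? toℕ a) (<-asym a<b) = refl

edgeCount-edge : ∀ {a b : Fin n} → a ≢ b → edgeCount (edge a b) ≤ 1
edgeCount-edge {a = a} {b} a≢b with <-cmp (toℕ a) (toℕ b)
... | tri< a<b _ _ = edgeCount-edge-< a<b
... | tri≈ _ a≡b _ = contradiction (toℕ-injective a≡b) a≢b
... | tri> _ _ b<a = ≤-trans (edgeCount-mono (λ i j e → trans (sym (edge-comm a b i j)) e)) (edgeCount-edge-< b<a)

restrict : EdgeRel n → Subset n → EdgeRel n
restrict E R i j = E i j ∧ does (i ∈? R ×-dec j ∈? R)

restrict⁺ : ∀ {E : EdgeRel n} {R i j} → E i j ≡ true → i ∈ R → j ∈ R → restrict E R i j ≡ true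
restrict⁺ {R = R} {i} {j} e i∈R j∈R rewrite e = dec-true (i ∈? R ×-dec j ∈? R) (i∈R , j∈R)

restrict⁻ : ∀ {E : EdgeRel n} {R i j} → restrict E R i j ≡ true → E i j ≡ true × (i ∈ R × j ∈ R)
restrict⁻ {E = E} {R} {i} {j} e with E i j
... | true = refl , does-true (i ∈? R ×-dec j ∈? R) e

restrict-outside : ∀ {E : EdgeRel n} {R i j} → ¬ (i ∈ R × j ∈ R) → restrict E R i j ≡ false
restrict-outside {E = E} {R} {i} {j} ij∉R rewrite dec-false (i ∈? R ×-dec j ∈? R) ij∉R = ∧-zeroʳ (E i j)

restrict-⊆ᴱ : ∀ {E : EdgeRel n} {R} → restrict E R ⊆ᴱ E
restrict-⊆ᴱ {E = E} {R} i j = proj₁ ∘ restrict⁻ {E = E} {R}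

restrict-mono : ∀ {E : EdgeRel n} {R R′} → R ⊆ R′ → restrict E R ⊆ᴱ restrict E R′
restrict-mono {E = E} {R} {R′} R⊆R′ i j e with restrict⁻ {E = E} {R} e
... | e′ , i∈R , j∈R = restrict⁺ {E = E} {R′} e′ (R⊆R′ i∈R) (R⊆R′ j∈R)

x∈p∪⁅x⁆ : ∀ {p : Subset n} {x} → x ∈ p ∪ ⁅ x ⁆
x∈p∪⁅x⁆ {x = x} = x∈p∪q⁺ (inj₂ (x∈⁅x⁆ x))

p⊆p∪⁅x⁆ : ∀ {p : Subset n} {x} → p ⊆ p ∪ ⁅ x ⁆
p⊆p∪⁅x⁆ {x = x} = p⊆p∪q ⁅ x ⁆

y∈p∪⁅x⁆⁻ : ∀ {p : Subset n} {x y} → y ∈ p ∪ ⁅ x ⁆ → y ∈ p ⊎ y ≡ x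
y∈p∪⁅x⁆⁻ {p = p} {x} y∈ = Sum.map₂ (x∈⁅y⁆⇒x≡y x) (x∈p∪q⁻ p ⁅ x ⁆ y∈)

∣p∪⁅x⁆∣≡1+∣p∣ : ∀ {p : Subset n} {x} → x ∉ p → ∣ p ∪ ⁅ x ⁆ ∣ ≡ suc ∣ p ∣
∣p∪⁅x⁆∣≡1+∣p∣ {p = inside  ∷ p} {zero}  x∉p = contradiction here x∉p
∣p∪⁅x⁆∣≡1+∣p∣ {p = outside ∷ p} {zero}  x∉p = cong (suc ∘ ∣_∣) (∪-identityʳ p)
∣p∪⁅x⁆∣≡1+∣p∣ {p = inside  ∷ p} {suc x} x∉p = cong suc (∣p∪⁅x⁆∣≡1+∣p∣ (x∉p ∘ there))
∣p∪⁅x⁆∣≡1+∣p∣ {p = outside ∷ p} {suc x} x∉p = ∣p∪⁅x⁆∣≡1+∣p∣ (x∉p ∘ there)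

∪-⊆ : ∀ {p q r : Subset n} → p ⊆ r → q ⊆ r → p ∪ q ⊆ r
∪-⊆ {p = p} {q} p⊆r q⊆r = Sum.[ p⊆r , q⊆r ] ∘ x∈p∪q⁻ p q

⁅x⁆⊆p : ∀ {p : Subset n} {x} → x ∈ p → ⁅ x ⁆ ⊆ p
⁅x⁆⊆p {p = p} {x} x∈p y∈⁅x⁆ = subst (_∈ p) (sym (x∈⁅y⁆⇒x≡y x y∈⁅x⁆)) x∈p

x∉p⇒p⊆∁⁅x⁆ : ∀ {p : Subset n} {x} → x ∉ p → p ⊆ ∁ ⁅ x ⁆
x∉p⇒p⊆∁⁅x⁆ {p = p} {x} x∉p y∈p = x∉p⇒x∈∁p λ y∈⁅x⁆ → x∉p (subst (_∈ p) (x∈⁅y⁆⇒x≡y x y∈⁅x⁆) y∈p)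

p⊂p∪⁅x⁆ : ∀ {p : Subset n} {x} → x ∉ p → p ⊂ p ∪ ⁅ x ⁆
p⊂p∪⁅x⁆ x∉p = p⊆p∪⁅x⁆ , _ , x∈p∪⁅x⁆ , x∉p

⊆⊎∃∉ : ∀ (p q : Subset n) → p ⊆ q ⊎ ∃ λ x → x ∈ p × x ∉ q
⊆⊎∃∉ p q with any? (λ x → x ∈? p ×-dec ¬? (x ∈? q))
... | yes (x , x∈p , x∉q) = inj₂ (x , x∈p , x∉q)
... | no ∄ = inj₁ λ {x} x∈p → decidable-stable (x ∈? q) (λ x∉q → ∄ (x , x∈p , x∉q))

nonempty : ∀ (p : Subset n) → 0 < ∣ p ∣ → Nonempty p
nonempty {n} p 0<∣p∣ with nonempty? p
... | yes ne = ne
... | no ¬ne = contradiction (trans (cong ∣_∣ (Empty-unique ¬ne)) (∣⊥∣≡0 n)) (>⇒≢ 0<∣p∣)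

enumerate : ∀ (p : Subset n) → Fin ∣ p ∣ → Fin n
enumerate (inside  ∷ p) zero    = zero
enumerate (inside  ∷ p) (suc i) = suc (enumerate p i)
enumerate (outside ∷ p) i       = suc (enumerate p i)

enumerate-∈ : ∀ (p : Subset n) i → enumerate p i ∈ p
enumerate-∈ (inside  ∷ p) zero    = here
enumerate-∈ (inside  ∷ p) (suc i) = there (enumerate-∈ p i)
enumerate-∈ (outside ∷ p) i       = there (enumerate-∈ p i)

enumerate-injective : ∀ (p : Subset n) → Injective _≡_ _≡_ (enumerate p)
enumerate-injective (inside  ∷ p) {zero}  {zero}  _  = refl
enumerate-injective (inside  ∷ p) {suc i} {suc j} eq = cong suc (enumerate-injective p (suc-injective eq))
enumerate-injective (outside ∷ p)                 eq = enumerate-injective p (suc-injective eq)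

image : ∀ {k} → (Fin k → Fin n) → Subset n
image {k = zero}  f = Subset.⊥
image {k = suc k} f = image (f ∘ suc) ∪ ⁅ f zero ⁆

image⁻ : ∀ {k} (f : Fin k → Fin n) {x} → x ∈ image f → ∃ λ i → f i ≡ x
image⁻ {k = zero}  f x∈ = contradiction x∈ ∉⊥
image⁻ {k = suc k} f x∈ with y∈p∪⁅x⁆⁻ x∈
... | inj₁ x∈′ with image⁻ (f ∘ suc) x∈′
...   | i , fi≡x = suc i , fi≡x
image⁻ {k = suc k} f x∈ | inj₂ x≡ = zero , sym x≡

∣image∣ : ∀ {k} (f : Fin k → Fin n) → Injective _≡_ _≡_ f → ∣ image f ∣ ≡ k
∣image∣ {n} {zero}  f _     = ∣⊥∣≡0 n
∣image∣ {k = suc k} f f-inj =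
  trans (∣p∪⁅x⁆∣≡1+∣p∣ f0∉) (cong suc (∣image∣ (f ∘ suc) (suc-injective ∘ f-inj)))
  where
  f0∉ : f zero ∉ image (f ∘ suc)
  f0∉ f0∈ with image⁻ (f ∘ suc) f0∈
  ... | i , fi≡f0 with f-inj fi≡f0
  ...   | ()

-- Walks and connectivity

walk-head : ∀ {W : Subset n} {E u v} → Walk W E u v → u ∈ W
walk-head (here u∈W)     = u∈W
walk-head (step u∈W _ _) = u∈W

walk-mono : ∀ {W W′ : Subset n} {E E′} → W ⊆ W′ → E ⊆ᴱ E′ → ∀ {u v} → Walk W E u v → Walk W′ E′ u v
walk-mono W⊆W′ E⊆E′ (here u∈W)       = here (W⊆W′ u∈W)
walk-mono W⊆W′ E⊆E′ (step u∈W e w) = step (W⊆W′ u∈W) (E⊆E′ _ _ e) (walk-mono W⊆W′ E⊆E′ w)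

walk-snoc : ∀ {W : Subset n} {E u v x} → Walk W E u v → E v x ≡ true → x ∈ W → Walk W E u x
walk-snoc (here u∈W)       e x∈W = step u∈W e (here x∈W)
walk-snoc (step u∈W e′ w) e x∈W = step u∈W e′ (walk-snoc w e x∈W)

connected-mono : ∀ {W : Subset n} {E E′} → E ⊆ᴱ E′ → IsConnectedOn W E → IsConnectedOn W E′
connected-mono E⊆E′ conn u v u∈W v∈W = walk-mono id E⊆E′ (conn u v u∈W v∈W)

Frontier : Subset n → EdgeRel n → Subset n → Fin n → Set
Frontier W E R x = x ∈ W × x ∉ R × ∃ λ y → y ∈ R × E y x ≡ true

walk-frontier : ∀ {W R : Subset n} {E u w} → Walk W E u w → u ∈ R → w ∉ R → ∃ (Frontier W E R)
walk-frontier (here _) u∈R w∉R = contradiction u∈R w∉R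
walk-frontier {R = R} (step {u} {x} _ e w) u∈R w∉R with x ∈? R
... | yes x∈R = walk-frontier w x∈R w∉R
... | no  x∉R = x , walk-head w , x∉R , u , u∈R , e

connected-∪⁅⁆ : ∀ {R : Subset n} {E x y} → IsConnectedOn R E → y ∈ R → E y x ≡ true → E x y ≡ true →
                IsConnectedOn (R ∪ ⁅ x ⁆) E
connected-∪⁅⁆ {R = R} {E} {x} {y} conn y∈R eyx exy = connected
  where
  lift : ∀ {a b} → Walk R E a b → Walk (R ∪ ⁅ x ⁆) E a b
  lift = walk-mono p⊆p∪⁅x⁆ ⊆ᴱ-refl
  connected : IsConnectedOn (R ∪ ⁅ x ⁆) E
  connected u v u∈ v∈ with y∈p∪⁅x⁆⁻ u∈ | y∈p∪⁅x⁆⁻ v∈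
  ... | inj₁ u∈R  | inj₁ v∈R  = lift (conn u v u∈R v∈R)
  ... | inj₁ u∈R  | inj₂ refl = walk-snoc (lift (conn u y u∈R y∈R)) eyx x∈p∪⁅x⁆
  ... | inj₂ refl | inj₁ v∈R  = step x∈p∪⁅x⁆ exy (lift (conn y v y∈R v∈R))
  ... | inj₂ refl | inj₂ refl = here x∈p∪⁅x⁆

growth-induction : ∀ {W : Subset n} {E} → IsConnectedOn W E → (Q : Subset n → Set) → Q W →
                   (∀ {R x} → R ⊆ W → Frontier W E R x → Q (R ∪ ⁅ x ⁆) → Q R) →
                   ∀ {R r} → R ⊆ W → r ∈ R → Q R
growth-induction {W = W} {E} conn Q QW extend {R} = go (⊃-wellFounded R)
  where
  go : ∀ {R r} → Acc _⊃_ R → R ⊆ W → r ∈ R → Q R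
  go {R} {r} (acc rec) R⊆W r∈R with ⊆⊎∃∉ W R
  ... | inj₁ W⊆R = subst Q (⊆-antisym W⊆R R⊆W) QW
  ... | inj₂ (w , w∈W , w∉R) with walk-frontier (conn r w (R⊆W r∈R) w∈W) r∈R w∉R
  ...   | x , fr@(x∈W , x∉R , _) =
    extend R⊆W fr (go (rec (p⊂p∪⁅x⁆ x∉R)) (∪-⊆ R⊆W (⁅x⁆⊆p x∈W)) (p⊆p∪⁅x⁆ r∈R))

-- Spanning trees and the edge bound for connected graphs

record SpanningTree (E : EdgeRel n) (W : Subset n) : Set where
  field
    tree        : EdgeRel n
    tree⊆ᴱ      : tree ⊆ᴱ E
    tree-sym    : SymmetricRel tree
    tree-within : EdgesWithin tree W
    tree-conn   : IsConnectedOn W tree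
    tree-size   : suc (edgeCount tree) ≤ ∣ W ∣
open SpanningTree

spanningTree-⁅⁆ : ∀ {E : EdgeRel n} w → SpanningTree E ⁅ w ⁆
spanningTree-⁅⁆ {n} w = record
  { tree        = ∅ᴱ
  ; tree⊆ᴱ      = λ _ _ ()
  ; tree-sym    = λ _ _ → refl
  ; tree-within = λ _ _ ()
  ; tree-conn   = λ u v u∈ v∈ → subst₂ (Walk ⁅ w ⁆ _) (sym (x∈⁅y⁆⇒x≡y w u∈)) (sym (x∈⁅y⁆⇒x≡y w v∈)) (here (x∈⁅x⁆ w))
  ; tree-size   = ≤-reflexive (trans (cong suc (edgeCount-∅ᴱ {n})) (sym (∣⁅x⁆∣≡1 w)))
  }

spanningTree-extend : ∀ {E : EdgeRel n} {W R x} → SymmetricRel E →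
                      SpanningTree E R → Frontier W E R x → SpanningTree E (R ∪ ⁅ x ⁆)
spanningTree-extend {E = E} {R = R} {x} E-sym T (_ , x∉R , y , y∈R , eyx) = record
  { tree        = tree′
  ; tree⊆ᴱ      = ∪ᴱ-elim (tree⊆ᴱ T) new⊆ᴱE
  ; tree-sym    = λ i j → cong₂ _∨_ (tree-sym T i j) (edge-sym x y i j)
  ; tree-within = ∪ᴱ-elim (λ i j e → Product.map p⊆p∪⁅x⁆ p⊆p∪⁅x⁆ (tree-within T i j e)) new-within
  ; tree-conn   = connected-∪⁅⁆ (connected-mono ⊆ᴱ-∪ᴱˡ (tree-conn T)) y∈R
                    (new⊆ᴱtree′ y x (edge-backward x y)) (new⊆ᴱtree′ x y (edge-forward x y))
  ; tree-size   = size
  }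
  where
  tree′ : EdgeRel _
  tree′ = tree T ∪ᴱ edge x y
  new⊆ᴱtree′ : edge x y ⊆ᴱ tree′
  new⊆ᴱtree′ = ⊆ᴱ-∪ᴱʳ {E = tree T}
  new⊆ᴱE : edge x y ⊆ᴱ E
  new⊆ᴱE i j e with edge⁻ x y i j e
  ... | inj₁ (refl , refl) = trans (E-sym x y) eyx
  ... | inj₂ (refl , refl) = eyx
  new-within : EdgesWithin (edge x y) (R ∪ ⁅ x ⁆)
  new-within i j e with edge⁻ x y i j e
  ... | inj₁ (refl , refl) = x∈p∪⁅x⁆ , p⊆p∪⁅x⁆ y∈R
  ... | inj₂ (refl , refl) = p⊆p∪⁅x⁆ y∈R , x∈p∪⁅x⁆
  x≢y : x ≢ y
  x≢y refl = x∉R y∈R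
  size : suc (edgeCount tree′) ≤ ∣ R ∪ ⁅ x ⁆ ∣
  size = begin
    suc (edgeCount tree′)                           ≤⟨ s≤s (edgeCount-∪ᴱ (tree T) (edge x y)) ⟩
    suc (edgeCount (tree T) + edgeCount (edge x y)) ≤⟨ s≤s (+-monoʳ-≤ _ (edgeCount-edge x≢y)) ⟩
    suc (edgeCount (tree T) + 1)                    ≡⟨ cong suc (+-comm _ 1) ⟩
    suc (suc (edgeCount (tree T)))                  ≤⟨ s≤s (tree-size T) ⟩
    suc ∣ R ∣                                       ≡⟨ sym (∣p∪⁅x⁆∣≡1+∣p∣ x∉R) ⟩
    ∣ R ∪ ⁅ x ⁆ ∣                                   ∎
    where open ≤-Reasoning

spanningTree : ∀ {W : Subset n} {E w} → IsConnectedOn W E → SymmetricRel E → w ∈ W → SpanningTree E W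
spanningTree {W = W} {E} {w} conn E-sym w∈W =
  growth-induction conn (λ R → SpanningTree E R → SpanningTree E W) id
    (λ _ fr grown T → grown (spanningTree-extend E-sym T fr))
    (⁅x⁆⊆p w∈W) (x∈⁅x⁆ w)
    (spanningTree-⁅⁆ w)

-- Each frontier vertex brings at least one new edge into the induced subgraph.
∣W∣≤1+edgeCount : ∀ {W : Subset n} {E w} → IsConnectedOn W E → SymmetricRel E → w ∈ W →
                  ∣ W ∣ ≤ suc (edgeCount E)
∣W∣≤1+edgeCount {W = W} {E} {w} conn E-sym w∈W =
  growth-induction conn Q (λ bound → ≤-trans bound (s≤s (edgeCount-mono (restrict-⊆ᴱ {E = E} {W})))) extend
    (⁅x⁆⊆p w∈W) (x∈⁅x⁆ w)
    (≤-trans (≤-reflexive (∣⁅x⁆∣≡1 w)) (s≤s z≤n))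
  where
  Q : Subset _ → Set
  Q R = ∣ R ∣ ≤ suc (edgeCount (restrict E R)) → ∣ W ∣ ≤ suc (edgeCount E)
  extend : ∀ {R x} → R ⊆ W → Frontier W E R x → Q (R ∪ ⁅ x ⁆) → Q R
  extend {R} {x} _ (_ , x∉R , y , y∈R , eyx) grown bound = grown (begin
    ∣ R ∪ ⁅ x ⁆ ∣                            ≡⟨ ∣p∪⁅x⁆∣≡1+∣p∣ x∉R ⟩
    suc ∣ R ∣                                ≤⟨ s≤s bound ⟩
    suc (suc (edgeCount (restrict E R)))     ≤⟨ s≤s new-edge ⟩
    suc (edgeCount (restrict E (R ∪ ⁅ x ⁆))) ∎)
    where
    open ≤-Reasoning
    x≢y : x ≢ y
    x≢y refl = x∉R y∈R
    new-edge : edgeCount (restrict E R) < edgeCount (restrict E (R ∪ ⁅ x ⁆))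
    new-edge = edgeCount-<-sym {E = restrict E R} {restrict E (R ∪ ⁅ x ⁆)} (restrict-mono {E = E} p⊆p∪⁅x⁆) x≢y
      (restrict-outside {E = E} (x∉R ∘ proj₁)) (restrict-outside {E = E} (x∉R ∘ proj₂))
      (restrict⁺ {E = E} (trans (E-sym x y) eyx) x∈p∪⁅x⁆ (p⊆p∪⁅x⁆ y∈R))
      (restrict⁺ {E = E} eyx (p⊆p∪⁅x⁆ y∈R) x∈p∪⁅x⁆)

-- Grow R to the whole vertex set: the vertex added last is not a cut vertex.
nonCutVertex-outside : ∀ {E : EdgeRel n} {R r w} → IsConnectedOn ⊤ E → SymmetricRel E →
                       IsConnectedOn R E → r ∈ R → w ∉ R → ∃ λ z → z ∉ R × IsConnectedOn (∁ ⁅ z ⁆) E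
nonCutVertex-outside {n} {E} conn E-sym R-conn r∈R w∉R =
  growth-induction conn Q (λ _ w∉⊤ → contradiction ∈⊤ w∉⊤) extend (λ _ → ∈⊤) r∈R R-conn w∉R
  where
  Q : Subset n → Set
  Q R = IsConnectedOn R E → ∀ {w} → w ∉ R → ∃ λ z → z ∉ R × IsConnectedOn (∁ ⁅ z ⁆) E
  extend : ∀ {R x} → R ⊆ ⊤ → Frontier ⊤ E R x → Q (R ∪ ⁅ x ⁆) → Q R
  extend {R} {x} _ (_ , x∉R , y , y∈R , eyx) grown R-conn _ with ⊆⊎∃∉ ⊤ (R ∪ ⁅ x ⁆)
  ... | inj₂ (v , _ , v∉) with grown (connected-∪⁅⁆ R-conn y∈R eyx (trans (E-sym x y) eyx)) v∉
  ...   | z , z∉ , z-conn = z , z∉ ∘ p⊆p∪⁅x⁆ , z-conn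
  extend {R} {x} _ (_ , x∉R , _) _ R-conn _ | inj₁ ⊤⊆R∪x =
    x , x∉R , λ u v u∈ v∈ → walk-mono (x∉p⇒p⊆∁⁅x⁆ x∉R) ⊆ᴱ-refl (R-conn u v (∁x⊆R u∈) (∁x⊆R v∈))
    where
    ∁x⊆R : ∁ ⁅ x ⁆ ⊆ R
    ∁x⊆R {u} u∈ with y∈p∪⁅x⁆⁻ (⊤⊆R∪x (∈⊤ {x = u}))
    ... | inj₁ u∈R  = u∈R
    ... | inj₂ refl = contradiction (x∈⁅x⁆ x) (x∈∁p⇒x∉p u∈)

-- Steiner distance and cut vertices

module _ {G : Graph n} where

  spanningConnSubgraph : ∀ {W S s} → IsConnectedOn W (adj G) → S ⊆ W → s ∈ S →
                         Σ[ H ∈ ConnSubgraph G S ] suc (edgeCount (E H)) ≤ ∣ W ∣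
  spanningConnSubgraph {W} {S} W-conn S⊆W s∈S = H , tree-size T
    where
    T : SpanningTree (adj G) W
    T = spanningTree W-conn (Graph.sym G) (S⊆W s∈S)
    H : ConnSubgraph G S
    H = record { W = W ; E = tree T ; Esym = tree-sym T ; Esub = tree⊆ᴱ T ; Eends = tree-within T
               ; conn = tree-conn T ; S⊆W = S⊆W }

  steinerDist<∣W∣ : ∀ {S W s d} → IsSteinerDist G S d → IsConnectedOn W (adj G) → S ⊆ W → s ∈ S → d < ∣ W ∣
  steinerDist<∣W∣ (_ , minimal) W-conn S⊆W s∈S with spanningConnSubgraph W-conn S⊆W s∈S
  ... | H , size = ≤-trans (s≤s (minimal H)) size

  steinerDist≤n∸1 : ∀ {S s d} → Connected G → IsSteinerDist G S d → s ∈ S → d ≤ n ∸ 1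
  steinerDist≤n∸1 {d = d} G-conn dist s∈S =
    ∸-monoˡ-≤ 1 (subst (suc d ≤_) (∣⊤∣≡n n) (steinerDist<∣W∣ dist G-conn (λ _ → ∈⊤) s∈S))

  -- Removing a non-cut vertex v ∉ S leaves a connected graph on n - 1 vertices containing S.
  steinerDist≡n∸1⇒cut : ∀ {S s v} → IsSteinerDist G S (n ∸ 1) → s ∈ S → v ∉ S → IsCutVertex G v
  steinerDist≡n∸1⇒cut {v = v} dist s∈S v∉S v-conn =
    <-irrefl (sym ∣∁⁅v⁆∣≡n∸1) (steinerDist<∣W∣ dist v-conn (x∉p⇒p⊆∁⁅x⁆ v∉S) s∈S)
    where
    ∣∁⁅v⁆∣≡n∸1 : ∣ ∁ ⁅ v ⁆ ∣ ≡ n ∸ 1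
    ∣∁⁅v⁆∣≡n∸1 = trans (∣∁p∣≡n∸∣p∣ ⁅ v ⁆) (cong (n ∸_) (∣⁅x⁆∣≡1 v))

  connSubgraph-spanning : ∀ {S s} → Connected G → (∀ {z} → z ∉ S → IsCutVertex G z) →
                          (H : ConnSubgraph G S) → s ∈ S → ⊤ ⊆ W H
  connSubgraph-spanning G-conn cut H s∈S {x} _ with x ∈? W H
  ... | yes x∈W = x∈W
  ... | no  x∉W with nonCutVertex-outside G-conn (Graph.sym G) (connected-mono (Esub H) (conn H)) (S⊆W H s∈S) x∉W
  ...   | z , z∉W , z-conn = contradiction z-conn (cut (z∉W ∘ S⊆W H))

  steinerDist-allCut : ∀ {S s} → Connected G → (∀ {z} → z ∉ S → IsCutVertex G z) → s ∈ S →
                       IsSteinerDist G S (n ∸ 1)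
  steinerDist-allCut {S} {s} G-conn cut s∈S with spanningConnSubgraph {W = ⊤} G-conn (λ _ → ∈⊤) s∈S
  ... | H₀ , size₀ = (H₀ , ≤-antisym upper (n∸1≤ H₀)) , n∸1≤
    where
    upper : edgeCount (E H₀) ≤ n ∸ 1
    upper = ∸-monoˡ-≤ 1 (subst (suc (edgeCount (E H₀)) ≤_) (∣⊤∣≡n n) size₀)
    n∸1≤ : ∀ (H : ConnSubgraph G S) → n ∸ 1 ≤ edgeCount (E H)
    n∸1≤ H = ∸-monoˡ-≤ 1 (begin
      n                     ≡⟨ sym (∣⊤∣≡n n) ⟩
      ∣ ⊤ {n} ∣             ≤⟨ p⊆q⇒∣p∣≤∣q∣ (connSubgraph-spanning G-conn cut H s∈S) ⟩
      ∣ W H ∣               ≤⟨ ∣W∣≤1+edgeCount (conn H) (Esym H) (S⊆W H s∈S) ⟩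
      suc (edgeCount (E H)) ∎)
      where open ≤-Reasoning

  atLeastCutVertices⇔ : ∀ {k} → AtLeastCutVertices G k ⇔ ∃ λ T → ∣ T ∣ ≡ k × (∀ {v} → v ∈ T → IsCutVertex G v)
  atLeastCutVertices⇔ = mk⇔
    (λ (f , f-inj , cut) → image f , ∣image∣ f f-inj , λ v∈ → subst (IsCutVertex G) (proj₂ (image⁻ f v∈)) (cut _))
    (λ (T , ∣T∣≡k , cut) → subst (AtLeastCutVertices G) ∣T∣≡k
      (enumerate T , enumerate-injective T , λ i → cut (enumerate-∈ T i)))

lemma2 : (n k : ℕ) → 1 ≤ k → k ≤ n ∸ 2 → (G : Graph n) → Connected G →
         IsSteinerDiam G (n ∸ k) (n ∸ 1) ⇔ AtLeastCutVertices G k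
lemma2 n k 1≤k k≤n∸2 G G-conn = mk⇔
  (λ ((S , ∣S∣≡n∸k , dist) , _) → Equivalence.from (atLeastCutVertices⇔ {G = G})
    ( ∁ S
    , trans (∣∁p∣≡n∸∣p∣ S) (trans (cong (n ∸_) ∣S∣≡n∸k) (m∸[m∸n]≡n (<⇒≤ k<n)))
    , λ v∈∁S → steinerDist≡n∸1⇒cut dist (proj₂ (member ∣S∣≡n∸k)) (x∈∁p⇒x∉p v∈∁S)))
  (λ atLeast →
    let (T , ∣T∣≡k , cut) = Equivalence.to (atLeastCutVertices⇔ {G = G}) atLeast
        ∣∁T∣≡n∸k = trans (∣∁p∣≡n∸∣p∣ T) (cong (n ∸_) ∣T∣≡k)
    in (∁ T , ∣∁T∣≡n∸k , steinerDist-allCut G-conn (cut ∘ x∉∁p⇒x∈p) (proj₂ (member ∣∁T∣≡n∸k)))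
     , λ S d ∣S∣≡n∸k dist → steinerDist≤n∸1 G-conn dist (proj₂ (member ∣S∣≡n∸k)))
  where
  k<n : k < n
  k<n = bound k≤n∸2
    where
    bound : ∀ {m} → k ≤ m ∸ 2 → k < m
    bound {zero}  k≤0 = contradiction (≤-trans 1≤k k≤0) λ ()
    bound {suc m} k≤m∸1 = s≤s (≤-trans k≤m∸1 (m∸n≤m m 1))
  member : ∀ {S} → ∣ S ∣ ≡ n ∸ k → Nonempty S
  member {S} ∣S∣≡n∸k = nonempty S (subst (0 <_) (sym ∣S∣≡n∸k) (m<n⇒0<n∸m k<n))
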